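{- Every graph $G=(V,S,U)$ with $n\ge 4$ vertices whose underlying graph $(V,S\cup U)$ is $2$-edge connected has an unsafe spanning connected subgraph with at most $2n-4$ edges.
   Context: A graph $G=(V,S,U)$ is an undirected graph whose edge set $S\cup U$ is partitioned into safe edges $S$ and unsafe edges $U$. An edge set $T\subseteq S\cup U$ is an unsafe spanning connected subgraph of $G$ if $(V,T)$ is connected and, for every unsafe edge $e\in T\cap U$, $(V,T\setminus\{e\})$ is connected. -}

module Defs where

open import Data.Nat using (ℕ)
open import Data.Bool using (Bool; true; false)
open import Data.Fin using (Fin)
open import Data.Fin.Subset using (Subset; _∈_; ⊤; _-_)
open import Data.Product using (_×_; _,_; proj₁; proj₂)
open import Data.Sum using (_⊎_)
open import Relation.Binary.PropositionalEquality using (_≡_)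
open import Relation.Nullary using (¬_)

-- Edges are indexed by Fin m; edge e joins  endpoints e  =  (u , v).
-- safe e ≡ true  means e ∈ S, safe e ≡ false  means e ∈ U; so S, U partition the edges.
record Graph (n : ℕ) : Set where
  field
    m        : ℕ
    endpoints : Fin m → Fin n × Fin n
    safe     : Fin m → Bool
    loopless : ∀ e → ¬ (proj₁ (endpoints e) ≡ proj₂ (endpoints e))
    simple   : ∀ e f → (proj₁ (endpoints e) ≡ proj₁ (endpoints f) × proj₂ (endpoints e) ≡ proj₂ (endpoints f))
                       ⊎ (proj₁ (endpoints e) ≡ proj₂ (endpoints f) × proj₂ (endpoints e) ≡ proj₁ (endpoints f))
                     → e ≡ f

module _ {n : ℕ} (G : Graph n) where
  open Graph G

  Joins : Fin m → Fin n → Fin n → Set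
  Joins e u v = (proj₁ (endpoints e) ≡ u × proj₂ (endpoints e) ≡ v)
              ⊎ (proj₁ (endpoints e) ≡ v × proj₂ (endpoints e) ≡ u)

  data Walk (T : Subset m) : Fin n → Fin n → Set where
    [] : ∀ {u} → Walk T u u
    step : ∀ {u w v} (e : Fin m) → e ∈ T → Joins e u w → Walk T w v → Walk T u v

  Connected : Subset m → Set
  Connected T = ∀ u v → Walk T u v

  TwoEdgeConnected : Set
  TwoEdgeConnected = Connected ⊤ × (∀ e → Connected (⊤ - e))

  UnsafeSpanningConnected : Subset m → Set
  UnsafeSpanningConnected T =
    Connected T × (∀ e → e ∈ T → safe e ≡ false → Connected (T - e))

{-# OPTIONS --safe #-}
module Submission where

-- The vertex set W grows from one vertex to all of V, carrying a strongly connected orientation A of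
-- edges inside W that uses every edge in one direction only.  Such an orientation is bridgeless: every
-- vertex reaches the tail of a given arc without traversing it, so deleting that edge keeps the graph
-- connected.  2-edge-connectivity supplies ears (an edge leaving W followed by a path back into W that
-- avoids it); orienting an ear along itself keeps A strongly connected, and an ear with k new vertices
-- costs k + 1 arcs.  This keeps |A| ≤ 2|W| − 4, except at a single vertex and at a triangle, where a
-- one-vertex ear replaces the triangle arc between its ends instead.

open import Defs
open import Data.Nat using (ℕ; _≤_; _*_; _∸_)
open import Data.Fin.Subset using (Subset; ∣_∣)
open import Data.Product using (Σ; _×_)

open import Data.Bool using (Bool; true; false)
open import Data.Empty using (⊥-elim)
open import Data.Fin as Fin using (Fin)
open import Data.Fin.Properties using (any?)
open import Data.Fin.Subset using (⊤; ⊥; ⁅_⁆; _∪_; _-_; _─_; inside; outside)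
  renaming (_∈_ to _∈ₛ_; _∉_ to _∉ₛ_)
open import Data.Fin.Subset.Properties
  using (_∈?_; ∈⊤; ∉⊥; x∈⁅x⁆; x∈⁅y⁆⇒x≡y; x∈p∪q⁺; x∈p∪q⁻; x∈p∧x≢y⇒x∈p-y;
         ∪-identityˡ; ∣⊥∣≡0; ∣⁅x⁆∣≡1; ∣p∣≤n; ∣p∣≡n⇒p≡⊤)
open import Data.List using (List; []; _∷_; _++_; length; filter)
open import Data.List.Membership.Propositional using (_∈_)
open import Data.List.Membership.Propositional.Properties using (∈-++⁺ˡ; ∈-++⁺ʳ; ∈-++⁻; ∈-filter⁺; ∈-filter⁻)
import Data.List.Membership.DecPropositional as DecMembership
open import Data.List.Properties using (length-++; filter-notAll)
open import Data.List.Relation.Unary.Any as Any using (here; there)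
open import Data.List.Relation.Unary.All using ([])
open import Data.List.Relation.Unary.All.Properties using (¬Any⇒All¬; All¬⇒¬Any)
open import Data.List.Relation.Unary.Unique.Propositional using (Unique; []; _∷_)
open import Data.Nat using (zero; suc; _+_; _<_; z≤n; s≤s)
open import Data.Nat.Properties
  using (≤-refl; ≤-reflexive; ≤-trans; ≤-antisym; ≤-pred; n≤1+n; m≤m+n; +-suc; +-identityʳ;
         +-mono-≤; +-monoˡ-≤; +-monoʳ-≤; m+n≤o⇒m≤o∸n; module ≤-Reasoning)
open import Data.Nat.Tactic.RingSolver using (solve-∀)
open import Data.Product using (_,_; proj₁; proj₂; map)
open import Data.Product.Properties using (×-≡,≡→≡)
open import Function using (_∘_)
open import Data.Sum as Sum using (_⊎_; inj₁; inj₂; [_,_]; map₁; reduce) renaming (swap to ⊎-swap)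
open import Data.Vec as Vec using (_∷_; [])
open import Relation.Binary.PropositionalEquality using (_≡_; _≢_; refl; sym; trans; cong; subst; subst₂)
open import Relation.Nullary using (yes; no; ¬?)
open import Relation.Nullary.Decidable using (decidable-stable)
open import Relation.Unary using (Decidable)

x∈p─q⇒x∉q : ∀ {k} {x : Fin k} (p q : Subset k) → x ∈ₛ p ─ q → x ∉ₛ q
x∈p─q⇒x∉q {x = Fin.zero}  (_ ∷ p) (outside ∷ q) x∈ ()
x∈p─q⇒x∉q {x = Fin.zero}  (_ ∷ p) (inside ∷ q)  ()
x∈p─q⇒x∉q {x = Fin.suc x} (_ ∷ p) (_ ∷ q) (Vec.there x∈) (Vec.there x∈q) = x∈p─q⇒x∉q p q x∈ x∈q

x∈p-y⇒x≢y : ∀ {k} {x y : Fin k} (p : Subset k) → x ∈ₛ p - y → x ≢ y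
x∈p-y⇒x≢y {y = y} p x∈ refl = x∈p─q⇒x∉q p ⁅ y ⁆ x∈ (x∈⁅x⁆ y)

∣p∪q∣≤∣p∣+∣q∣ : ∀ {k} (p q : Subset k) → ∣ p ∪ q ∣ ≤ ∣ p ∣ + ∣ q ∣
∣p∪q∣≤∣p∣+∣q∣ []            []            = z≤n
∣p∪q∣≤∣p∣+∣q∣ (outside ∷ p) (outside ∷ q) = ∣p∪q∣≤∣p∣+∣q∣ p q
∣p∪q∣≤∣p∣+∣q∣ (outside ∷ p) (inside ∷ q)  = ≤-trans (s≤s (∣p∪q∣≤∣p∣+∣q∣ p q)) (≤-reflexive (sym (+-suc ∣ p ∣ ∣ q ∣)))
∣p∪q∣≤∣p∣+∣q∣ (inside ∷ p)  (outside ∷ q) = s≤s (∣p∪q∣≤∣p∣+∣q∣ p q)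
∣p∪q∣≤∣p∣+∣q∣ (inside ∷ p)  (inside ∷ q)  = s≤s (≤-trans (∣p∪q∣≤∣p∣+∣q∣ p q) (+-monoʳ-≤ ∣ p ∣ (n≤1+n _)))

x∉p⇒∣⁅x⁆∪p∣≡1+∣p∣ : ∀ {k} (x : Fin k) (p : Subset k) → x ∉ₛ p → ∣ ⁅ x ⁆ ∪ p ∣ ≡ suc ∣ p ∣
x∉p⇒∣⁅x⁆∪p∣≡1+∣p∣ Fin.zero    (outside ∷ p) x∉ = cong suc (cong ∣_∣ (∪-identityˡ p))
x∉p⇒∣⁅x⁆∪p∣≡1+∣p∣ Fin.zero    (inside ∷ p)  x∉ = ⊥-elim (x∉ Vec.here)
x∉p⇒∣⁅x⁆∪p∣≡1+∣p∣ (Fin.suc x) (outside ∷ p) x∉ = x∉p⇒∣⁅x⁆∪p∣≡1+∣p∣ x p (x∉ ∘ Vec.there)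
x∉p⇒∣⁅x⁆∪p∣≡1+∣p∣ (Fin.suc x) (inside ∷ p)  x∉ = cong suc (x∉p⇒∣⁅x⁆∪p∣≡1+∣p∣ x p (x∉ ∘ Vec.there))

insertAll : ∀ {k} → List (Fin k) → Subset k → Subset k
insertAll []       W = W
insertAll (y ∷ ys) W = ⁅ y ⁆ ∪ insertAll ys W

module _ {k} {x : Fin k} where

  ∈-insertAllˡ : ∀ ys W → x ∈ ys → x ∈ₛ insertAll ys W
  ∈-insertAllˡ (y ∷ ys) W (here refl) = x∈p∪q⁺ (inj₁ (x∈⁅x⁆ y))
  ∈-insertAllˡ (y ∷ ys) W (there x∈) = x∈p∪q⁺ (inj₂ (∈-insertAllˡ ys W x∈))

  ∈-insertAllʳ : ∀ ys W → x ∈ₛ W → x ∈ₛ insertAll ys W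
  ∈-insertAllʳ []       W x∈ = x∈
  ∈-insertAllʳ (y ∷ ys) W x∈ = x∈p∪q⁺ (inj₂ (∈-insertAllʳ ys W x∈))

  ∈-insertAll⁻ : ∀ ys W → x ∈ₛ insertAll ys W → x ∈ ys ⊎ x ∈ₛ W
  ∈-insertAll⁻ []       W x∈ = inj₂ x∈
  ∈-insertAll⁻ (y ∷ ys) W x∈ with x∈p∪q⁻ ⁅ y ⁆ (insertAll ys W) x∈
  ... | inj₁ x∈⁅y⁆ = inj₁ (here (x∈⁅y⁆⇒x≡y y x∈⁅y⁆))
  ... | inj₂ x∈′   = map₁ there (∈-insertAll⁻ ys W x∈′)

∣insertAll∣ : ∀ {k} ys (W : Subset k) → Unique ys → (∀ {y} → y ∈ ys → y ∉ₛ W) →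
  ∣ insertAll ys W ∣ ≡ length ys + ∣ W ∣
∣insertAll∣ []       W []         disjoint = refl
∣insertAll∣ (y ∷ ys) W (y∉ ∷ uniq) disjoint =
  trans (x∉p⇒∣⁅x⁆∪p∣≡1+∣p∣ y (insertAll ys W) y∉ys∪W) (cong suc (∣insertAll∣ ys W uniq (disjoint ∘ there)))
  where
  y∉ys∪W : y ∉ₛ insertAll ys W
  y∉ys∪W y∈ = [ All¬⇒¬Any y∉ , disjoint (here refl) ] (∈-insertAll⁻ ys W y∈)

module _ {L w : ℕ} where
  open ≤-Reasoning

  slack-after-ear : ∀ s k → L + s ≤ w + w → 5 ≤ s + k → suc (k + L) + 4 ≤ (k + w) + (k + w)
  slack-after-ear s k slack enough = begin
    suc (k + L) + 4        ≡⟨ regroupˡ k L ⟩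
    (k + L) + 5            ≤⟨ +-monoʳ-≤ (k + L) enough ⟩
    (k + L) + (s + k)      ≡⟨ regroupᵐ k L s ⟩
    (L + s) + (k + k)      ≤⟨ +-monoˡ-≤ (k + k) slack ⟩
    (w + w) + (k + k)      ≡⟨ regroupʳ w k ⟩
    (k + w) + (k + w)      ∎
    where
    regroupˡ : ∀ k L → suc (k + L) + 4 ≡ (k + L) + 5
    regroupˡ = solve-∀
    regroupᵐ : ∀ k L s → (k + L) + (s + k) ≡ (L + s) + (k + k)
    regroupᵐ = solve-∀
    regroupʳ : ∀ w k → (w + w) + (k + k) ≡ (k + w) + (k + w)
    regroupʳ = solve-∀

  slack-after-bypass : ∀ {L′} → L′ ≤ suc L → L + 3 ≤ w + w → L′ + 4 ≤ suc w + suc w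
  slack-after-bypass {L′} L′≤ slack = begin
    L′ + 4              ≤⟨ +-monoˡ-≤ 4 L′≤ ⟩
    suc L + 4           ≡⟨ regroupˡ L ⟩
    2 + (L + 3)         ≤⟨ +-monoʳ-≤ 2 slack ⟩
    2 + (w + w)         ≡⟨ regroupʳ w ⟩
    suc w + suc w       ∎
    where
    regroupˡ : ∀ L → suc L + 4 ≡ 2 + (L + 3)
    regroupˡ = solve-∀
    regroupʳ : ∀ w → 2 + (w + w) ≡ suc w + suc w
    regroupʳ = solve-∀

module _ {n : ℕ} (G : Graph n) where
  open Graph G
  open DecMembership (Fin._≟_ {n}) using () renaming (_∈?_ to _∈ˡ?_)

  -- Strongly connected one-way orientations

  -- An arc is an edge with a direction of traversal: true runs from the first endpoint to the second.
  Arc : Set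
  Arc = Fin m × Bool

  edge : Arc → Fin m
  edge = proj₁

  tail head : Arc → Fin n
  tail (e , true)  = proj₁ (endpoints e)
  tail (e , false) = proj₂ (endpoints e)
  head (e , true)  = proj₂ (endpoints e)
  head (e , false) = proj₁ (endpoints e)

  arc-joins : (o : Arc) → Joins G (edge o) (tail o) (head o)
  arc-joins (e , true)  = inj₁ (refl , refl)
  arc-joins (e , false) = inj₂ (refl , refl)

  module _ {e : Fin m} {u v : Fin n} where

    direction : Joins G e u v → Bool
    direction (inj₁ _) = true
    direction (inj₂ _) = false

    arcOf : Joins G e u v → Arc
    arcOf J = e , direction J

    tail-arcOf : (J : Joins G e u v) → tail (arcOf J) ≡ u
    tail-arcOf (inj₁ (p , q)) = p
    tail-arcOf (inj₂ (p , q)) = q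

    head-arcOf : (J : Joins G e u v) → head (arcOf J) ≡ v
    head-arcOf (inj₁ (p , q)) = q
    head-arcOf (inj₂ (p , q)) = p

  tail≡head-reverse : ∀ e {b b′} → b ≢ b′ → tail (e , b) ≡ head (e , b′)
  tail≡head-reverse e {true}  {true}  b≢b′ = ⊥-elim (b≢b′ refl)
  tail≡head-reverse e {true}  {false} b≢b′ = refl
  tail≡head-reverse e {false} {true}  b≢b′ = refl
  tail≡head-reverse e {false} {false} b≢b′ = ⊥-elim (b≢b′ refl)

  same-edge-inside : ∀ {W : Subset n} {o o′ : Arc} → edge o ≡ edge o′ →
    tail o ∈ₛ W × head o ∈ₛ W → tail o′ ∈ₛ W × head o′ ∈ₛ W
  same-edge-inside {o = e , true}  {.e , true}  refl (t , h) = t , h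
  same-edge-inside {o = e , true}  {.e , false} refl (t , h) = h , t
  same-edge-inside {o = e , false} {.e , true}  refl (t , h) = h , t
  same-edge-inside {o = e , false} {.e , false} refl (t , h) = t , h

  joins-unique : ∀ {e e′ u v} → Joins G e u v → Joins G e′ u v → e ≡ e′
  joins-unique (inj₁ (a , b)) (inj₁ (c , d)) = simple _ _ (inj₁ (trans a (sym c) , trans b (sym d)))
  joins-unique (inj₁ (a , b)) (inj₂ (c , d)) = simple _ _ (inj₂ (trans a (sym d) , trans b (sym c)))
  joins-unique (inj₂ (a , b)) (inj₁ (c , d)) = simple _ _ (inj₂ (trans a (sym d) , trans b (sym c)))
  joins-unique (inj₂ (a , b)) (inj₂ (c , d)) = simple _ _ (inj₁ (trans a (sym c) , trans b (sym d)))

  ends-distinct : ∀ {e₀ e₁ a y b} → Joins G e₀ a y → Joins G e₁ y b → e₁ ≢ e₀ → a ≢ b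
  ends-distinct J₀ J₁ e₁≢e₀ refl = e₁≢e₀ (sym (joins-unique J₀ (⊎-swap J₁)))

  data DiWalk (A : List Arc) : Fin n → Fin n → Set where
    []   : ∀ {u} → DiWalk A u u
    step : ∀ {u w v} (o : Arc) → o ∈ A → tail o ≡ u → head o ≡ w → DiWalk A w v → DiWalk A u v

  _++ᵈ_ : ∀ {A u v w} → DiWalk A u v → DiWalk A v w → DiWalk A u w
  []                ++ᵈ q = q
  step o o∈ t h p   ++ᵈ q = step o o∈ t h (p ++ᵈ q)

  diwalk-mono : ∀ {A B u v} → (∀ {o} → o ∈ A → o ∈ B) → DiWalk A u v → DiWalk B u v
  diwalk-mono A⊆B []                = []
  diwalk-mono A⊆B (step o o∈ t h p) = step o (A⊆B o∈) t h (diwalk-mono A⊆B p)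

  _∷ᵈ_ : ∀ {A e u v w} (J : Joins G e u v) → DiWalk A v w → DiWalk (arcOf J ∷ A) u w
  J ∷ᵈ p = step (arcOf J) (here refl) (tail-arcOf J) (head-arcOf J) (diwalk-mono there p)

  OneWay : List Arc → Set
  OneWay A = ∀ {o o′} → o ∈ A → o′ ∈ A → edge o ≡ edge o′ → proj₂ o ≡ proj₂ o′

  oneWay-∷ : ∀ {o A} → OneWay A → (∀ {o′} → o′ ∈ A → edge o ≡ edge o′ → proj₂ o ≡ proj₂ o′) → OneWay (o ∷ A)
  oneWay-∷ oneWay new (here refl) (here refl) eq = refl
  oneWay-∷ oneWay new (here refl) (there o′∈) eq = new o′∈ eq
  oneWay-∷ oneWay new (there o∈)  (here refl) eq = sym (new o∈ (sym eq))
  oneWay-∷ oneWay new (there o∈)  (there o′∈) eq = oneWay o∈ o′∈ eq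

  oneWay-++ : ∀ {A B} → OneWay A → OneWay B → (∀ {o o′} → o ∈ A → o′ ∈ B → edge o ≢ edge o′) → OneWay (A ++ B)
  oneWay-++ {A} oneWayA oneWayB disjoint o∈ o′∈ eq with ∈-++⁻ A o∈ | ∈-++⁻ A o′∈
  ... | inj₁ o∈A | inj₁ o′∈A = oneWayA o∈A o′∈A eq
  ... | inj₁ o∈A | inj₂ o′∈B = ⊥-elim (disjoint o∈A o′∈B eq)
  ... | inj₂ o∈B | inj₁ o′∈A = ⊥-elim (disjoint o′∈A o∈B (sym eq))
  ... | inj₂ o∈B | inj₂ o′∈B = oneWayB o∈B o′∈B eq

  same-arc : ∀ {A} → OneWay A → ∀ {o o′} → o ∈ A → o′ ∈ A → edge o ≡ edge o′ → o ≡ o′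
  same-arc oneWay o∈ o′∈ same = ×-≡,≡→≡ (same , oneWay o∈ o′∈ same)

  record StrongOrientation (W : Subset n) (A : List Arc) : Set where
    field
      arcs-inside : ∀ {o} → o ∈ A → tail o ∈ₛ W × head o ∈ₛ W
      strong : ∀ {u v} → u ∈ₛ W → v ∈ₛ W → DiWalk A u v
      oneWay : OneWay A

  inside-by-edge : ∀ {W A o o′} → StrongOrientation W A → o′ ∈ A → edge o ≡ edge o′ → tail o ∈ₛ W × head o ∈ₛ W
  inside-by-edge {o = o} {o′} S o′∈ same =
    same-edge-inside {o = o′} {o} (sym same) (StrongOrientation.arcs-inside S o′∈)

  edges : List Arc → Subset m
  edges []      = ⊥
  edges (o ∷ A) = ⁅ edge o ⁆ ∪ edges A

  ∈-edges⁺ : ∀ {o A} → o ∈ A → edge o ∈ₛ edges A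
  ∈-edges⁺ {o} (here refl) = x∈p∪q⁺ (inj₁ (x∈⁅x⁆ (edge o)))
  ∈-edges⁺     (there o∈)  = x∈p∪q⁺ (inj₂ (∈-edges⁺ o∈))

  ∈-edges⁻ : ∀ {e} A → e ∈ₛ edges A → Σ Arc λ o → o ∈ A × edge o ≡ e
  ∈-edges⁻ []      e∈ = ⊥-elim (∉⊥ e∈)
  ∈-edges⁻ (o ∷ A) e∈ with x∈p∪q⁻ ⁅ edge o ⁆ (edges A) e∈
  ... | inj₁ e∈⁅o⁆ = o , here refl , sym (x∈⁅y⁆⇒x≡y _ e∈⁅o⁆)
  ... | inj₂ e∈A with ∈-edges⁻ A e∈A
  ...   | o′ , o′∈ , eq = o′ , there o′∈ , eq

  ∣edges∣≤length : ∀ A → ∣ edges A ∣ ≤ length A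
  ∣edges∣≤length []      = ≤-reflexive (∣⊥∣≡0 m)
  ∣edges∣≤length (o ∷ A) = begin
    ∣ ⁅ edge o ⁆ ∪ edges A ∣       ≤⟨ ∣p∪q∣≤∣p∣+∣q∣ ⁅ edge o ⁆ (edges A) ⟩
    ∣ ⁅ edge o ⁆ ∣ + ∣ edges A ∣   ≡⟨ cong (_+ ∣ edges A ∣) (∣⁅x⁆∣≡1 (edge o)) ⟩
    suc ∣ edges A ∣                ≤⟨ s≤s (∣edges∣≤length A) ⟩
    suc (length A)                 ∎
    where open ≤-Reasoning

  _++ʷ_ : ∀ {T u v w} → Walk G T u v → Walk G T v w → Walk G T u w
  []              ++ʷ q = q
  step e e∈ J p   ++ʷ q = step e e∈ J (p ++ʷ q)

  reverse : ∀ {T u v} → Walk G T u v → Walk G T v u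
  reverse []             = []
  reverse (step e e∈ J p) = reverse p ++ʷ step e e∈ (⊎-swap J) []

  arc-joins′ : ∀ o {u v} → tail o ≡ u → head o ≡ v → Joins G (edge o) u v
  arc-joins′ o t h = subst₂ (Joins G (edge o)) t h (arc-joins o)

  undirect : ∀ {A u v} → DiWalk A u v → Walk G (edges A) u v
  undirect []                = []
  undirect (step o o∈ t h p) = step (edge o) (∈-edges⁺ o∈) (arc-joins′ o t h) (undirect p)

  -- Since A is one-way, a walk can only traverse the edge of o from its tail to its head.
  walk-until-arc : ∀ {A} → OneWay A → ∀ {o} → o ∈ A → ∀ {u v} → DiWalk A u v →
    Walk G (edges A - edge o) u v ⊎ Walk G (edges A - edge o) u (tail o)
  walk-until-arc oneWay o∈ [] = inj₁ []
  walk-until-arc {A} oneWay {o} o∈ (step o′ o′∈ t h p) with edge o′ Fin.≟ edge o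
  ... | yes same = inj₂ (subst (λ x → Walk G _ x (tail o)) (trans (cong tail (same-arc oneWay o∈ o′∈ (sym same))) t) [])
  ... | no differ = Sum.map prepend prepend (walk-until-arc oneWay o∈ p)
    where
    prepend : ∀ {x} → Walk G (edges A - edge o) _ x → Walk G (edges A - edge o) _ x
    prepend = step (edge o′) (x∈p∧x≢y⇒x∈p-y (∈-edges⁺ o′∈) differ) (arc-joins′ o′ t h)

  module _ {W A} (S : StrongOrientation W A) (spanning : ∀ x → x ∈ₛ W) where
    open StrongOrientation S

    strong⇒connected : Connected G (edges A)
    strong⇒connected u v = undirect (strong (spanning u) (spanning v))

    strong⇒bridgeless : ∀ e → e ∈ₛ edges A → Connected G (edges A - e)
    strong⇒bridgeless e e∈ u v with ∈-edges⁻ A e∈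
    ... | o , o∈ , refl = toTail u ++ʷ reverse (toTail v)
      where
      toTail : ∀ x → Walk G (edges A - edge o) x (tail o)
      toTail x = reduce (walk-until-arc oneWay o∈ (strong (spanning x) (spanning (tail o))))

  -- Ears

  data EntryPath (W : Subset n) (T : Subset m) (c : Fin n) : Set where
    enter : c ∉ₛ W → (e : Fin m) → e ∈ₛ T → (b : Fin n) → Joins G e c b → b ∈ₛ W → EntryPath W T c
    move  : c ∉ₛ W → (e : Fin m) → e ∈ₛ T → (y : Fin n) → Joins G e c y → EntryPath W T y → EntryPath W T c

  module _ {W : Subset n} {T : Subset m} where

    entry : ∀ {c} → EntryPath W T c → Fin n
    entry (enter _ _ _ b _ _) = b
    entry (move _ _ _ _ _ p)  = entry p

    entry∈ : ∀ {c} (p : EntryPath W T c) → entry p ∈ₛ W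
    entry∈ (enter _ _ _ _ _ b∈) = b∈
    entry∈ (move _ _ _ _ _ p)   = entry∈ p

    start∉ : ∀ {c} → EntryPath W T c → c ∉ₛ W
    start∉ (enter c∉ _ _ _ _ _) = c∉
    start∉ (move c∉ _ _ _ _ _)  = c∉

    inner : ∀ {c} → EntryPath W T c → List (Fin n)
    inner {c} (enter _ _ _ _ _ _) = c ∷ []
    inner {c} (move _ _ _ _ _ p)  = c ∷ inner p

    arcs : ∀ {c} → EntryPath W T c → List Arc
    arcs (enter _ _ _ _ J _) = arcOf J ∷ []
    arcs (move _ _ _ _ J p)  = arcOf J ∷ arcs p

    start∈inner : ∀ {c} (p : EntryPath W T c) → c ∈ inner p
    start∈inner (enter _ _ _ _ _ _) = here refl
    start∈inner (move _ _ _ _ _ _)  = here refl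

    inner-nonempty : ∀ {c} (p : EntryPath W T c) → 1 ≤ length (inner p)
    inner-nonempty (enter _ _ _ _ _ _) = s≤s z≤n
    inner-nonempty (move _ _ _ _ _ _)  = s≤s z≤n

    length-arcs : ∀ {c} (p : EntryPath W T c) → length (arcs p) ≡ length (inner p)
    length-arcs (enter _ _ _ _ _ _) = refl
    length-arcs (move _ _ _ _ _ p)  = cong suc (length-arcs p)

    inner∉ : ∀ {c y} (p : EntryPath W T c) → y ∈ inner p → y ∉ₛ W
    inner∉ (enter c∉ _ _ _ _ _) (here refl) = c∉
    inner∉ (move c∉ _ _ _ _ _)  (here refl) = c∉
    inner∉ (move _ _ _ _ _ p)   (there y∈)  = inner∉ p y∈

    arcs⊆T : ∀ {c o} (p : EntryPath W T c) → o ∈ arcs p → edge o ∈ₛ T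
    arcs⊆T (enter _ _ e∈ _ _ _) (here refl) = e∈
    arcs⊆T (move _ _ e∈ _ _ _)  (here refl) = e∈
    arcs⊆T (move _ _ _ _ _ p)   (there o∈)  = arcs⊆T p o∈

    tail∈inner : ∀ {c o} (p : EntryPath W T c) → o ∈ arcs p → tail o ∈ inner p
    tail∈inner (enter _ _ _ _ J _) (here refl) = here (tail-arcOf J)
    tail∈inner (move _ _ _ _ J _)  (here refl) = here (tail-arcOf J)
    tail∈inner (move _ _ _ _ _ p)  (there o∈)  = there (tail∈inner p o∈)

    head∈inner⊎entry : ∀ {c o} (p : EntryPath W T c) → o ∈ arcs p → head o ∈ inner p ⊎ head o ≡ entry p
    head∈inner⊎entry (enter _ _ _ _ J _) (here refl) = inj₂ (head-arcOf J)
    head∈inner⊎entry (move _ _ _ _ J p)  (here refl) = inj₁ (there (subst (_∈ inner p) (sym (head-arcOf J)) (start∈inner p)))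
    head∈inner⊎entry (move _ _ _ _ _ p)  (there o∈)  = map₁ there (head∈inner⊎entry p o∈)

    toEntry : ∀ {c y} (p : EntryPath W T c) → y ∈ inner p → DiWalk (arcs p) y (entry p)
    toEntry (enter _ _ _ _ J _) (here refl) = J ∷ᵈ []
    toEntry (move _ _ _ _ J p)  (here refl) = J ∷ᵈ toEntry p (start∈inner p)
    toEntry (move _ _ _ _ _ p)  (there y∈)  = diwalk-mono there (toEntry p y∈)

    fromStart : ∀ {c y} (p : EntryPath W T c) → y ∈ inner p → DiWalk (arcs p) c y
    fromStart (enter _ _ _ _ _ _) (here refl) = []
    fromStart (move _ _ _ _ _ _)  (here refl) = []
    fromStart (move _ _ _ _ J p)  (there y∈)  = J ∷ᵈ fromStart p y∈

    -- An arc of p traversing the first edge backwards would end at c, which p never revisits.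
    oneWay-arcs : ∀ {c} (p : EntryPath W T c) → Unique (inner p) → OneWay (arcs p)
    oneWay-arcs (enter _ _ _ _ _ _) _ = oneWay-∷ (λ ()) (λ ())
    oneWay-arcs {c} (move c∉ e _ y J p) (c∉p ∷ uniq) = oneWay-∷ (oneWay-arcs p uniq) same-direction
      where
      head≡c : ∀ {b′} → direction J ≢ b′ → head (e , b′) ≡ c
      head≡c differ = trans (sym (tail≡head-reverse e differ)) (tail-arcOf J)

      same-direction : ∀ {o′} → o′ ∈ arcs p → e ≡ edge o′ → direction J ≡ proj₂ o′
      same-direction {e , b′} o′∈ refl with direction J Data.Bool.≟ b′
      ... | yes same = same
      ... | no differ with head∈inner⊎entry p o′∈
      ...   | inj₁ head∈p     = ⊥-elim (All¬⇒¬Any c∉p (subst (_∈ inner p) (head≡c differ) head∈p))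
      ...   | inj₂ head≡entry = ⊥-elim (c∉ (subst (_∈ₛ W) (trans (sym head≡entry) (head≡c differ)) (entry∈ p)))

    suffixFrom : ∀ {c y} (p : EntryPath W T y) → c ∈ inner p →
      Σ (EntryPath W T c) λ q → Unique (inner p) → Unique (inner q)
    suffixFrom p@(enter _ _ _ _ _ _) (here refl) = p , λ uniq → uniq
    suffixFrom p@(move _ _ _ _ _ _)  (here refl) = p , λ uniq → uniq
    suffixFrom (move _ _ _ _ _ p)    (there c∈)  with suffixFrom p c∈
    ... | q , unique-q = q , λ { (_ ∷ uniq) → unique-q uniq }

    shortcut : ∀ {c} → EntryPath W T c → Σ (EntryPath W T c) λ q → Unique (inner q)
    shortcut p@(enter _ _ _ _ _ _) = p , [] ∷ []
    shortcut {c} (move c∉ e e∈ y J p) with shortcut p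
    ... | q , unique-q with c ∈ˡ? inner q
    ...   | yes c∈q = let r , unique-r = suffixFrom q c∈q in r , unique-r unique-q
    ...   | no c∉q  = move c∉ e e∈ y J q , ¬Any⇒All¬ (inner q) c∉q ∷ unique-q

    first-entry : ∀ {c t} → Walk G T c t → c ∉ₛ W → t ∈ₛ W → EntryPath W T c
    first-entry []                            c∉ t∈ = ⊥-elim (c∉ t∈)
    first-entry (step {w = y} e e∈ J walk) c∉ t∈ with y ∈? W
    ... | yes y∈ = enter c∉ e e∈ y J y∈
    ... | no y∉  = move c∉ e e∈ y J (first-entry walk y∉ t∈)

  exit-edge : ∀ {W : Subset n} {T : Subset m} {u x} → Walk G T u x → u ∈ₛ W → x ∉ₛ W →
    Σ (Fin n) λ a → Σ (Fin n) λ y → Σ (Fin m) λ e → a ∈ₛ W × y ∉ₛ W × Joins G e a y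
  exit-edge []                       u∈ x∉ = ⊥-elim (x∉ u∈)
  exit-edge {W} (step {w = y} e _ J walk) u∈ x∉ with y ∈? W
  ... | yes y∈ = exit-edge walk y∈ x∉
  ... | no y∉  = _ , y , e , u∈ , y∉ , J

  avoids? : (e : Fin m) → Decidable (λ (o : Arc) → edge o ≢ e)
  avoids? e o = ¬? (edge o Fin.≟ e)

  without : Fin m → List Arc → List Arc
  without e = filter (avoids? e)

  length-without : ∀ {o A} → o ∈ A → length (without (edge o) A) < length A
  length-without {o} {A} o∈ = filter-notAll (avoids? (edge o)) A (Any.map (λ { refl differ → differ refl }) o∈)

  drop-redundant : ∀ {W A o} → StrongOrientation W A → o ∈ A →
    DiWalk (without (edge o) A) (tail o) (head o) → StrongOrientation W (without (edge o) A)
  drop-redundant {W} {A} {o} S o∈ bypass = record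
    { arcs-inside = arcs-inside ∘ ⊆A
    ; strong      = λ u∈ v∈ → reroute (strong u∈ v∈)
    ; oneWay      = λ o₁∈ o₂∈ → oneWay (⊆A o₁∈) (⊆A o₂∈)
    }
    where
    open StrongOrientation S
    A′ = without (edge o) A

    ⊆A : ∀ {o′} → o′ ∈ A′ → o′ ∈ A
    ⊆A = proj₁ ∘ ∈-filter⁻ (avoids? (edge o))

    reroute : ∀ {u v} → DiWalk A u v → DiWalk A′ u v
    reroute [] = []
    reroute (step o′ o′∈ t h p) with edge o′ Fin.≟ edge o
    ... | yes same = subst₂ (DiWalk A′) (trans (cong tail o≡o′) t) (trans (cong head o≡o′) h) bypass ++ᵈ reroute p
      where
      o≡o′ : o ≡ o′
      o≡o′ = same-arc oneWay o∈ o′∈ (sym same)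
    ... | no differ = step o′ (∈-filter⁺ (avoids? (edge o)) o′∈ differ) t h (reroute p)

  record Ear (W : Subset n) : Set where
    field
      foot first : Fin n
      e₀         : Fin m
      foot∈      : foot ∈ₛ W
      joins₀     : Joins G e₀ foot first
      path       : EntryPath W (⊤ - e₀) first
      distinct   : Unique (inner path)

    newVertices : List (Fin n)
    newVertices = inner path

    newArcs : List Arc
    newArcs = arcOf joins₀ ∷ arcs path

  ear-exists : ∀ {W v x} → TwoEdgeConnected G → v ∈ₛ W → x ∉ₛ W → Ear W
  ear-exists {W} (connected , bridgeless) v∈ x∉ with exit-edge {W} (connected _ _) v∈ x∉
  ... | a , y , e , a∈ , y∉ , J with shortcut (first-entry (bridgeless e y a) y∉ a∈)
  ...   | p , unique-p = record { foot∈ = a∈ ; joins₀ = J ; path = p ; distinct = unique-p }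

  module _ {W : Subset n} (E : Ear W) where
    open Ear E

    length-newArcs : ∀ A → length (newArcs ++ A) ≡ suc (length newVertices + length A)
    length-newArcs A = cong suc (trans (length-++ (arcs path)) (cong (_+ length A) (length-arcs path)))

    ∣insertAll-newVertices∣ : ∣ insertAll newVertices W ∣ ≡ length newVertices + ∣ W ∣
    ∣insertAll-newVertices∣ = ∣insertAll∣ newVertices W distinct (inner∉ path)

    ear-edges-new : ∀ {A} → StrongOrientation W A → ∀ {o o′} → o ∈ newArcs → o′ ∈ A → edge o ≢ edge o′
    ear-edges-new S (here refl) o′∈ same =
      start∉ path (subst (_∈ₛ W) (head-arcOf joins₀) (proj₂ (inside-by-edge {o = arcOf joins₀} S o′∈ same)))
    ear-edges-new S {o} (there o∈p) o′∈ same =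
      inner∉ path (tail∈inner path o∈p) (proj₁ (inside-by-edge {o = o} S o′∈ same))

    add-ear : ∀ {A} → StrongOrientation W A → StrongOrientation (insertAll newVertices W) (newArcs ++ A)
    add-ear {A} S = record { arcs-inside = inside′ ; strong = strong′ ; oneWay = oneWay′ }
      where
      open StrongOrientation S
      W′ = insertAll newVertices W
      A′ = newArcs ++ A

      ⊆A′ˡ : ∀ {o} → o ∈ arcs path → o ∈ A′
      ⊆A′ˡ o∈ = there (∈-++⁺ˡ o∈)
      ⊆A′ʳ : ∀ {o} → o ∈ A → o ∈ A′
      ⊆A′ʳ o∈ = there (∈-++⁺ʳ (arcs path) o∈)
      ⊆W′ˡ : ∀ {x} → x ∈ newVertices → x ∈ₛ W′
      ⊆W′ˡ = ∈-insertAllˡ newVertices W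
      ⊆W′ʳ : ∀ {x} → x ∈ₛ W → x ∈ₛ W′
      ⊆W′ʳ = ∈-insertAllʳ newVertices W

      inside′ : ∀ {o} → o ∈ A′ → tail o ∈ₛ W′ × head o ∈ₛ W′
      inside′ (here refl) = subst (_∈ₛ W′) (sym (tail-arcOf joins₀)) (⊆W′ʳ foot∈)
                          , subst (_∈ₛ W′) (sym (head-arcOf joins₀)) (⊆W′ˡ (start∈inner path))
      inside′ (there o∈) with ∈-++⁻ (arcs path) o∈
      ... | inj₁ o∈p = ⊆W′ˡ (tail∈inner path o∈p)
                     , [ ⊆W′ˡ , (λ h≡ → subst (_∈ₛ W′) (sym h≡) (⊆W′ʳ (entry∈ path))) ] (head∈inner⊎entry path o∈p)
      ... | inj₂ o∈A = map ⊆W′ʳ ⊆W′ʳ (arcs-inside o∈A)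

      toEntry′ : ∀ {x} → x ∈ₛ W′ → DiWalk A′ x (entry path)
      toEntry′ x∈ with ∈-insertAll⁻ newVertices W x∈
      ... | inj₁ x∈p = diwalk-mono ⊆A′ˡ (toEntry path x∈p)
      ... | inj₂ x∈W = diwalk-mono ⊆A′ʳ (strong x∈W (entry∈ path))

      fromFoot : ∀ {x} → x ∈ₛ W′ → DiWalk A′ foot x
      fromFoot x∈ with ∈-insertAll⁻ newVertices W x∈
      ... | inj₁ x∈p = joins₀ ∷ᵈ diwalk-mono ∈-++⁺ˡ (fromStart path x∈p)
      ... | inj₂ x∈W = diwalk-mono ⊆A′ʳ (strong foot∈ x∈W)

      strong′ : ∀ {x y} → x ∈ₛ W′ → y ∈ₛ W′ → DiWalk A′ x y
      strong′ x∈ y∈ = toEntry′ x∈ ++ᵈ (diwalk-mono ⊆A′ʳ (strong (entry∈ path) foot∈) ++ᵈ fromFoot y∈)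

      e₀-new : ∀ {o′} → o′ ∈ arcs path ++ A → e₀ ≡ edge o′ → direction joins₀ ≡ proj₂ o′
      e₀-new o′∈ same with ∈-++⁻ (arcs path) o′∈
      ... | inj₁ o′∈p = ⊥-elim (x∈p-y⇒x≢y ⊤ (arcs⊆T path o′∈p) (sym same))
      ... | inj₂ o′∈A = ⊥-elim (ear-edges-new S (here refl) o′∈A same)

      oneWay′ : OneWay A′
      oneWay′ = oneWay-∷ (oneWay-++ (oneWay-arcs path distinct) oneWay (ear-edges-new S ∘ there)) e₀-new

    bypass-arc : ∀ {A o} → StrongOrientation W A → o ∈ A → tail o ≡ foot → head o ≡ entry path →
      Σ (List Arc) λ A′ → StrongOrientation (insertAll newVertices W) A′ × length A′ ≤ length newVertices + length A
    bypass-arc {A} {o} S o∈ tail≡ head≡ =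
      without (edge o) A₁ , drop-redundant (add-ear S) o∈A₁ bypass ,
      ≤-pred (subst (length (without (edge o) A₁) <_) (length-newArcs A) (length-without o∈A₁))
      where
      A₁ = newArcs ++ A
      o∈A₁ : o ∈ A₁
      o∈A₁ = ∈-++⁺ʳ newArcs o∈
      keep : ∀ {o′} → o′ ∈ newArcs → o′ ∈ without (edge o) A₁
      keep o′∈ = ∈-filter⁺ (avoids? (edge o)) (∈-++⁺ˡ o′∈) (ear-edges-new S o′∈ o∈)
      earWalk : DiWalk newArcs foot (entry path)
      earWalk = joins₀ ∷ᵈ toEntry path (start∈inner path)
      bypass : DiWalk (without (edge o) A₁) (tail o) (head o)
      bypass = subst₂ (DiWalk _) (sym tail≡) (sym head≡) (diwalk-mono keep earWalk)

  -- Counting arcs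

  Joined : List Arc → Fin n → Fin n → Set
  Joined A p q = Σ Arc λ o → o ∈ A × ((tail o ≡ p × head o ≡ q) ⊎ (tail o ≡ q × head o ≡ p))

  joined-sym : ∀ {A p q} → Joined A p q → Joined A q p
  joined-sym (o , o∈ , ends) = o , o∈ , ⊎-swap ends

  arcOf-joined : ∀ {A e u v} (J : Joins G e u v) → arcOf J ∈ A → Joined A u v
  arcOf-joined J o∈ = arcOf J , o∈ , inj₁ (tail-arcOf J , head-arcOf J)

  Complete : Subset n → List Arc → Set
  Complete W A = ∀ {p q} → p ∈ₛ W → q ∈ₛ W → p ≢ q → Joined A p q

  triangle-complete : ∀ {W A x y z} → Joined A x y → Joined A y z → Joined A z x →
    (∀ {p} → p ∈ₛ W → p ≡ x ⊎ p ≡ y ⊎ p ≡ z) → Complete W A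
  triangle-complete xy yz zx classify p∈ q∈ p≢q with classify p∈ | classify q∈
  ... | inj₁ refl        | inj₁ refl        = ⊥-elim (p≢q refl)
  ... | inj₁ refl        | inj₂ (inj₁ refl) = xy
  ... | inj₁ refl        | inj₂ (inj₂ refl) = joined-sym zx
  ... | inj₂ (inj₁ refl) | inj₁ refl        = joined-sym xy
  ... | inj₂ (inj₁ refl) | inj₂ (inj₁ refl) = ⊥-elim (p≢q refl)
  ... | inj₂ (inj₁ refl) | inj₂ (inj₂ refl) = yz
  ... | inj₂ (inj₂ refl) | inj₁ refl        = zx
  ... | inj₂ (inj₂ refl) | inj₂ (inj₁ refl) = joined-sym yz
  ... | inj₂ (inj₂ refl) | inj₂ (inj₂ refl) = ⊥-elim (p≢q refl)

  -- roomy is |A| ≤ 2|W| − 4, which fails at a single vertex (point) and at a triangle (clique).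
  data Budget : Subset n → List Arc → Set where
    roomy  : ∀ {W A} → length A + 4 ≤ ∣ W ∣ + ∣ W ∣ → Budget W A
    clique : ∀ {W A} → length A + 3 ≤ ∣ W ∣ + ∣ W ∣ → length A ≤ 3 → Complete W A → Budget W A
    point  : ∀ v → Budget ⁅ v ⁆ []

  Progress : Subset n → Set
  Progress W = Σ (List Arc) λ A → StrongOrientation W A × Budget W A

  grow-roomy : ∀ {W A} s → StrongOrientation W A → length A + s ≤ ∣ W ∣ + ∣ W ∣ →
    (E : Ear W) → 5 ≤ s + length (Ear.newVertices E) → Progress (insertAll (Ear.newVertices E) W)
  grow-roomy {W} {A} s S slack E enough =
    Ear.newArcs E ++ A , add-ear E S ,
    roomy (subst₂ (λ L w → L + 4 ≤ w + w) (sym (length-newArcs E A)) (sym (∣insertAll-newVertices∣ E))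
                  (slack-after-ear s (length (Ear.newVertices E)) slack enough))

  roomy-after-bypass : ∀ {W} {A : List Arc} {y} → y ∉ₛ W → length A + 3 ≤ ∣ W ∣ + ∣ W ∣ →
    Σ (List Arc) (λ A′ → StrongOrientation (insertAll (y ∷ []) W) A′ × length A′ ≤ 1 + length A) →
    Progress (insertAll (y ∷ []) W)
  roomy-after-bypass {W} {y = y} y∉ slack (A′ , S′ , A′≤) =
    A′ , S′ , roomy (subst (λ w → length A′ + 4 ≤ w + w) (sym (x∉p⇒∣⁅x⁆∪p∣≡1+∣p∣ y W y∉)) (slack-after-bypass A′≤ slack))

  extend : ∀ {W} → Progress W → (E : Ear W) → Progress (insertAll (Ear.newVertices E) W)
  extend (A , S , roomy slack) E = grow-roomy 4 S slack E (+-monoʳ-≤ 4 (inner-nonempty (Ear.path E)))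
  extend (A , S , clique slack _ _) E@record { path = move _ _ _ _ _ p } =
    grow-roomy 3 S slack E (+-monoʳ-≤ 4 (inner-nonempty p))
  extend {W} (A , S , clique slack _ complete)
         E@record { foot = a ; e₀ = e₀ ; foot∈ = a∈ ; joins₀ = J₀ ; path = enter y∉ e₁ e₁∈ b J₁ b∈ }
    with complete a∈ b∈ (ends-distinct J₀ J₁ (x∈p-y⇒x≢y ⊤ e₁∈))
  ... | o , o∈ , inj₁ (tail≡a , head≡b) = roomy-after-bypass {A = A} y∉ slack (bypass-arc E S o∈ tail≡a head≡b)
  ... | o , o∈ , inj₂ (tail≡b , head≡a) = roomy-after-bypass {A = A} y∉ slack (bypass-arc reversed S o∈ tail≡b head≡a)
    where
    reversed : Ear W
    reversed = record { foot∈ = b∈ ; joins₀ = ⊎-swap J₁ ; distinct = [] ∷ []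
                      ; path = enter y∉ e₀ (x∈p∧x≢y⇒x∈p-y ∈⊤ (x∈p-y⇒x≢y ⊤ e₁∈ ∘ sym)) a (⊎-swap J₀) a∈ }
  extend (_ , S , point v) record { foot∈ = a∈ ; joins₀ = J₀ ; path = enter _ _ e₁∈ _ J₁ b∈ } =
    ⊥-elim (ends-distinct J₀ J₁ (x∈p-y⇒x≢y ⊤ e₁∈) (trans (x∈⁅y⁆⇒x≡y v a∈) (sym (x∈⁅y⁆⇒x≡y v b∈))))
  extend (_ , S , point v) E@record { path = move _ _ _ _ _ (move _ _ _ _ _ p) } =
    grow-roomy 2 S (subst (λ w → 2 ≤ w + w) (sym (∣⁅x⁆∣≡1 v)) ≤-refl) E (+-monoʳ-≤ 4 (inner-nonempty p))
  extend (_ , S , point v) E@record { foot∈ = a∈ ; joins₀ = J₀ ; path = move _ _ _ y₂ J₁ (enter _ _ _ _ J₂ b∈) }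
    with x∈⁅y⁆⇒x≡y v a∈ | x∈⁅y⁆⇒x≡y v b∈
  ... | refl | refl = Ear.newArcs E , add-ear E S , clique slack ≤-refl complete
    where
    slack : 3 + 3 ≤ ∣ insertAll (Ear.newVertices E) ⁅ v ⁆ ∣ + ∣ insertAll (Ear.newVertices E) ⁅ v ⁆ ∣
    slack = subst (λ w → 3 + 3 ≤ w + w) (sym (trans (∣insertAll-newVertices∣ E) (cong (2 +_) (∣⁅x⁆∣≡1 v)))) ≤-refl
    classify : ∀ {p} → p ∈ₛ insertAll (Ear.newVertices E) ⁅ v ⁆ → p ≡ v ⊎ p ≡ Ear.first E ⊎ p ≡ y₂
    classify p∈ with ∈-insertAll⁻ (Ear.newVertices E) ⁅ v ⁆ p∈
    ... | inj₁ (here p≡y₁)         = inj₂ (inj₁ p≡y₁)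
    ... | inj₁ (there (here p≡y₂)) = inj₂ (inj₂ p≡y₂)
    ... | inj₂ p∈⁅v⁆               = inj₁ (x∈⁅y⁆⇒x≡y v p∈⁅v⁆)
    complete : Complete (insertAll (Ear.newVertices E) ⁅ v ⁆) (Ear.newArcs E)
    complete = triangle-complete (arcOf-joined J₀ (here refl)) (arcOf-joined J₁ (there (here refl)))
                                 (arcOf-joined J₂ (there (there (here refl)))) classify

  budget⇒bound : ∀ {W A} → Budget W A → ∣ W ∣ ≤ n → 4 ≤ n → length A ≤ 2 * n ∸ 4
  budget⇒bound {W} {A} (roomy slack) ∣W∣≤n _ = m+n≤o⇒m≤o∸n (length A) (begin
    length A + 4   ≤⟨ slack ⟩
    ∣ W ∣ + ∣ W ∣  ≤⟨ +-mono-≤ ∣W∣≤n ∣W∣≤n ⟩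
    n + n          ≡⟨ cong (n +_) (sym (+-identityʳ n)) ⟩
    2 * n          ∎)
    where open ≤-Reasoning
  budget⇒bound {W} {A} (clique _ A≤3 _) _ 4≤n = ≤-trans A≤3 (m+n≤o⇒m≤o∸n 3 (begin
    3 + 4          ≤⟨ n≤1+n 7 ⟩
    4 + 4          ≤⟨ +-mono-≤ 4≤n 4≤n ⟩
    n + n          ≡⟨ cong (n +_) (sym (+-identityʳ n)) ⟩
    2 * n          ∎))
    where open ≤-Reasoning
  budget⇒bound (point _) _ _ = z≤n

  start : ∀ v → Progress ⁅ v ⁆
  start v = [] , record { arcs-inside = λ () ; strong = trivial ; oneWay = λ () } , point v
    where
    trivial : ∀ {x y} → x ∈ₛ ⁅ v ⁆ → y ∈ₛ ⁅ v ⁆ → DiWalk [] x y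
    trivial x∈ y∈ = subst (DiWalk [] _) (trans (x∈⁅y⁆⇒x≡y v x∈) (sym (x∈⁅y⁆⇒x≡y v y∈))) []

  module _ (2ec : TwoEdgeConnected G) {v : Fin n} where

    grow-spanning : ∀ fuel {W} → v ∈ₛ W → n ≤ fuel + ∣ W ∣ → Progress W →
      Σ (Subset n) λ W′ → (∀ x → x ∈ₛ W′) × Progress W′
    grow-spanning fuel {W} v∈ room P with any? (λ x → ¬? (x ∈? W))
    ... | no nothing-missing = W , (λ x → decidable-stable (x ∈? W) (λ x∉ → nothing-missing (x , x∉))) , P
    grow-spanning zero {W} v∈ room P | yes (x , x∉) =
      ⊥-elim (x∉ (subst (x ∈ₛ_) (sym (∣p∣≡n⇒p≡⊤ (≤-antisym (∣p∣≤n W) room))) ∈⊤))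
    grow-spanning (suc fuel) {W} v∈ room P | yes (x , x∉) =
      grow-spanning fuel (∈-insertAllʳ (Ear.newVertices E) W v∈) room′ (extend P E)
      where
      open ≤-Reasoning
      E = ear-exists 2ec v∈ x∉
      room′ : n ≤ fuel + ∣ insertAll (Ear.newVertices E) W ∣
      room′ = begin
        n                                       ≤⟨ room ⟩
        suc fuel + ∣ W ∣                        ≡⟨ sym (+-suc fuel ∣ W ∣) ⟩
        fuel + (1 + ∣ W ∣)                      ≤⟨ +-monoʳ-≤ fuel (+-monoˡ-≤ ∣ W ∣ (inner-nonempty (Ear.path E))) ⟩
        fuel + (length (Ear.newVertices E) + ∣ W ∣) ≡⟨ cong (fuel +_) (sym (∣insertAll-newVertices∣ E)) ⟩
        fuel + ∣ insertAll (Ear.newVertices E) W ∣ ∎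

proposition12 : (n : ℕ) → 4 ≤ n → (G : Graph n) → TwoEdgeConnected G →
    Σ (Subset (Graph.m G)) (λ T → UnsafeSpanningConnected G T × ∣ T ∣ ≤ 2 * n ∸ 4)
proposition12 n@(suc _) 4≤n G 2ec
  with grow-spanning G 2ec n (x∈⁅x⁆ Fin.zero) (m≤m+n n _) (start G Fin.zero)
... | W , spanning , A , S , budget =
  edges G A ,
  (strong⇒connected G S spanning , λ e e∈ _ → strong⇒bridgeless G S spanning e e∈) ,
  ≤-trans (∣edges∣≤length G A) (budget⇒bound G budget (∣p∣≤n W) 4≤n)
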